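{- Let $n_1,n_2,n_3\ge 2$ and let $S$ be a set of vertices of $P_{n_1}\Box P_{n_2}\Box P_{n_3}$. If there exist $a_1\in\{1,\dots,n_1-1\}$ and $a_2\in\{1,\dots,n_2-1\}$ such that $\mathrm{pr}_3(S)\subseteq R_{ -- }(a_1,a_2)\cup R_{++}(a_1,a_2)$ or $\mathrm{pr}_3(S)\subseteq R_{ -+}(a_1,a_2)\cup R_{+- }(a_1,a_2)$, then $S$ is not a resolving set for $P_{n_1}\Box P_{n_2}\Box P_{n_3}$.
   Context: $P_{n_1}\Box P_{n_2}\Box P_{n_3}$ is the grid graph with vertex set $\{(x_1,x_2,x_3): 0\le x_i\le n_i-1\}$, two vertices adjacent iff they differ by exactly $1$ in exactly one coordinate; $d(x,y)=\sum_i|x_i-y_i|$. A set $S$ is resolving if every pair of distinct vertices $x,y$ has some $w\in S$ with $d(w,x)\ne d(w,y)$. $\mathrm{pr}_3(S)=\{(x_1,x_2):(x_1,x_2,x_3)\in S\}$. In $\{0,\dots,n_1-1\}\times\{0,\dots,n_2-1\}$: $R_{ -- }(a_1,a_2)=\{(x_1,x_2):x_1<a_1,x_2<a_2\}$, $R_{++}(a_1,a_2)=\{(x_1,x_2):x_1\ge a_1,x_2\ge a_2\}$, $R_{ -+}(a_1,a_2)=\{(x_1,x_2):x_1<a_1,x_2\ge a_2\}$, $R_{+- }(a_1,a_2)=\{(x_1,x_2):x_1\ge a_1,x_2<a_2\}$. -}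

module Defs where

open import Data.Nat using (ℕ; _+_; _<_; _≥_; ∣_-_∣)
open import Data.Fin using (Fin; toℕ)
open import Data.Product using (_×_; _,_; Σ-syntax)
open import Data.Sum using (_⊎_)
open import Relation.Binary.PropositionalEquality using (_≡_; _≢_)

Vertex : ℕ → ℕ → ℕ → Set
Vertex n₁ n₂ n₃ = Fin n₁ × Fin n₂ × Fin n₃

dist : ∀ {n₁ n₂ n₃} → Vertex n₁ n₂ n₃ → Vertex n₁ n₂ n₃ → ℕ
dist (x₁ , x₂ , x₃) (y₁ , y₂ , y₃) =
  ∣ toℕ x₁ - toℕ y₁ ∣ + ∣ toℕ x₂ - toℕ y₂ ∣ + ∣ toℕ x₃ - toℕ y₃ ∣

VSet : ℕ → ℕ → ℕ → Set₁
VSet n₁ n₂ n₃ = Vertex n₁ n₂ n₃ → Set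

Resolving : ∀ {n₁ n₂ n₃} → VSet n₁ n₂ n₃ → Set
Resolving {n₁} {n₂} {n₃} S =
  (x y : Vertex n₁ n₂ n₃) → x ≢ y →
  Σ[ w ∈ Vertex n₁ n₂ n₃ ] (S w × dist w x ≢ dist w y)

Rmm Rpp Rmp Rpm : ℕ → ℕ → ℕ → ℕ → Set
Rmm a₁ a₂ x₁ x₂ = x₁ < a₁ × x₂ < a₂
Rpp a₁ a₂ x₁ x₂ = x₁ ≥ a₁ × x₂ ≥ a₂
Rmp a₁ a₂ x₁ x₂ = x₁ < a₁ × x₂ ≥ a₂
Rpm a₁ a₂ x₁ x₂ = x₁ ≥ a₁ × x₂ < a₂

Pr₃⊆∪ : ∀ {n₁ n₂ n₃} → VSet n₁ n₂ n₃ → (ℕ → ℕ → Set) → (ℕ → ℕ → Set) → Set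
Pr₃⊆∪ {n₁} {n₂} {n₃} S A B =
  (v : Vertex n₁ n₂ n₃) → S v →
  let (x₁ , x₂ , _) = v in A (toℕ x₁) (toℕ x₂) ⊎ B (toℕ x₁) (toℕ x₂)

module Submission where

open import Defs
open import Data.Nat using (ℕ; zero; suc; _+_; _≤_; _<_; ∣_-_∣; s≤s)
open import Data.Nat.Properties using (+-suc; <-trans; n<1+n; 1+n≢n)
import Data.Fin as Fin
open Fin using (Fin; toℕ; fromℕ<)
open import Data.Fin.Properties using (toℕ-fromℕ<)
open import Data.Product using (_×_; Σ-syntax; _,_)
open import Data.Sum using (_⊎_; inj₁; inj₂)
open import Relation.Nullary using (¬_)
open import Relation.Binary.PropositionalEquality

-- Idea: with a = (b₁ + 1, b₂ + 1), the vertices (b₁, b₂ + 1, c) and (b₁ + 1, b₂, c)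
-- are at equal distance from every vertex projecting into R₋₋(a) ∪ R₊₊(a): seen
-- from such a vertex, moving from one to the other brings it one step closer in
-- one coordinate and one step farther in the other.  Likewise (b₁, b₂, c) and
-- (b₁ + 1, b₂ + 1, c) cannot be told apart from R₋₊(a) ∪ R₊₋(a).

∣m-1+n∣≡1+∣m-n∣ : ∀ {m n} → m ≤ n → ∣ m - suc n ∣ ≡ suc ∣ m - n ∣
∣m-1+n∣≡1+∣m-n∣ {zero}  {n}     _       = refl
∣m-1+n∣≡1+∣m-n∣ {suc m} {suc n} (s≤s p) = ∣m-1+n∣≡1+∣m-n∣ p

∣m-n∣≡1+∣m-1+n∣ : ∀ {m n} → n < m → ∣ m - n ∣ ≡ suc ∣ m - suc n ∣
∣m-n∣≡1+∣m-1+n∣ {suc zero}    {zero}  _       = refl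
∣m-n∣≡1+∣m-1+n∣ {suc (suc m)} {zero}  _       = refl
∣m-n∣≡1+∣m-1+n∣ {suc m}       {suc n} (s≤s p) = ∣m-n∣≡1+∣m-1+n∣ p

antidiagonal-equidistant : ∀ {b₁ b₂ w₁ w₂} →
  Rmm (suc b₁) (suc b₂) w₁ w₂ ⊎ Rpp (suc b₁) (suc b₂) w₁ w₂ →
  ∣ w₁ - b₁ ∣ + ∣ w₂ - suc b₂ ∣ ≡ ∣ w₁ - suc b₁ ∣ + ∣ w₂ - b₂ ∣
antidiagonal-equidistant (inj₁ (s≤s p , s≤s q))
  rewrite ∣m-1+n∣≡1+∣m-n∣ p | ∣m-1+n∣≡1+∣m-n∣ q = +-suc _ _
antidiagonal-equidistant (inj₂ (p , q))
  rewrite ∣m-n∣≡1+∣m-1+n∣ p | ∣m-n∣≡1+∣m-1+n∣ q = sym (+-suc _ _)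

diagonal-equidistant : ∀ {b₁ b₂ w₁ w₂} →
  Rmp (suc b₁) (suc b₂) w₁ w₂ ⊎ Rpm (suc b₁) (suc b₂) w₁ w₂ →
  ∣ w₁ - b₁ ∣ + ∣ w₂ - b₂ ∣ ≡ ∣ w₁ - suc b₁ ∣ + ∣ w₂ - suc b₂ ∣
diagonal-equidistant (inj₁ (s≤s p , q))
  rewrite ∣m-1+n∣≡1+∣m-n∣ p | ∣m-n∣≡1+∣m-1+n∣ q = +-suc _ _
diagonal-equidistant (inj₂ (p , s≤s q))
  rewrite ∣m-n∣≡1+∣m-1+n∣ p | ∣m-1+n∣≡1+∣m-n∣ q = sym (+-suc _ _)

module _ {n₁ n₂ n₃ : ℕ} (S : VSet n₁ n₂ n₃) where

  ¬Resolving-if-unresolved : (x y : Vertex n₁ n₂ n₃) → x ≢ y →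
    (∀ w → S w → dist w x ≡ dist w y) → ¬ Resolving S
  ¬Resolving-if-unresolved x y x≢y equidistant resolving
    with resolving x y x≢y
  ... | w , w∈S , dist≢ = dist≢ (equidistant w w∈S)

  ¬Resolving-if-unresolved-in-layer : (x₁ y₁ : Fin n₁) (x₂ y₂ : Fin n₂) (c : Fin n₃) →
    x₁ ≢ y₁ →
    (∀ w₁ w₂ w₃ → S (w₁ , w₂ , w₃) →
      ∣ toℕ w₁ - toℕ x₁ ∣ + ∣ toℕ w₂ - toℕ x₂ ∣ ≡ ∣ toℕ w₁ - toℕ y₁ ∣ + ∣ toℕ w₂ - toℕ y₂ ∣) →
    ¬ Resolving S
  ¬Resolving-if-unresolved-in-layer x₁ y₁ x₂ y₂ c x₁≢y₁ equidistant =
    ¬Resolving-if-unresolved (x₁ , x₂ , c) (y₁ , y₂ , c) (λ { refl → x₁≢y₁ refl })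
      λ { (w₁ , w₂ , w₃) w∈S → cong (_+ ∣ toℕ w₃ - toℕ c ∣) (equidistant w₁ w₂ w₃ w∈S) }

module Corner {n₁ n₂ : ℕ} (b₁ b₂ : ℕ) (a₁<n₁ : suc b₁ < n₁) (a₂<n₂ : suc b₂ < n₂) where

  i₀ i₁ : Fin n₁
  i₀ = fromℕ< (<-trans (n<1+n b₁) a₁<n₁)
  i₁ = fromℕ< a₁<n₁

  j₀ j₁ : Fin n₂
  j₀ = fromℕ< (<-trans (n<1+n b₂) a₂<n₂)
  j₁ = fromℕ< a₂<n₂

  i₀≢i₁ : i₀ ≢ i₁
  i₀≢i₁ i₀≡i₁ = 1+n≢n (begin
    suc b₁    ≡⟨ toℕ-fromℕ< a₁<n₁ ⟨
    toℕ i₁    ≡⟨ cong toℕ i₀≡i₁ ⟨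
    toℕ i₀    ≡⟨ toℕ-fromℕ< _ ⟩
    b₁        ∎)
    where open ≡-Reasoning

  antidiagonal-equidistantᶠ : ∀ (w₁ : Fin n₁) (w₂ : Fin n₂) →
    Rmm (suc b₁) (suc b₂) (toℕ w₁) (toℕ w₂) ⊎ Rpp (suc b₁) (suc b₂) (toℕ w₁) (toℕ w₂) →
    ∣ toℕ w₁ - toℕ i₀ ∣ + ∣ toℕ w₂ - toℕ j₁ ∣ ≡ ∣ toℕ w₁ - toℕ i₁ ∣ + ∣ toℕ w₂ - toℕ j₀ ∣
  antidiagonal-equidistantᶠ _ _ w∈R
    rewrite toℕ-fromℕ< (<-trans (n<1+n b₁) a₁<n₁) | toℕ-fromℕ< a₁<n₁
          | toℕ-fromℕ< (<-trans (n<1+n b₂) a₂<n₂) | toℕ-fromℕ< a₂<n₂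
    = antidiagonal-equidistant w∈R

  diagonal-equidistantᶠ : ∀ (w₁ : Fin n₁) (w₂ : Fin n₂) →
    Rmp (suc b₁) (suc b₂) (toℕ w₁) (toℕ w₂) ⊎ Rpm (suc b₁) (suc b₂) (toℕ w₁) (toℕ w₂) →
    ∣ toℕ w₁ - toℕ i₀ ∣ + ∣ toℕ w₂ - toℕ j₀ ∣ ≡ ∣ toℕ w₁ - toℕ i₁ ∣ + ∣ toℕ w₂ - toℕ j₁ ∣
  diagonal-equidistantᶠ _ _ w∈R
    rewrite toℕ-fromℕ< (<-trans (n<1+n b₁) a₁<n₁) | toℕ-fromℕ< a₁<n₁
          | toℕ-fromℕ< (<-trans (n<1+n b₂) a₂<n₂) | toℕ-fromℕ< a₂<n₂
    = diagonal-equidistant w∈R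

lemma4 : (n₁ n₂ n₃ : ℕ) → 2 ≤ n₁ → 2 ≤ n₂ → 2 ≤ n₃ →
    (S : VSet n₁ n₂ n₃) →
    (Σ[ a₁ ∈ ℕ ] Σ[ a₂ ∈ ℕ ] ((1 ≤ a₁ × a₁ < n₁) × (1 ≤ a₂ × a₂ < n₂) ×
      (Pr₃⊆∪ S (Rmm a₁ a₂) (Rpp a₁ a₂) ⊎ Pr₃⊆∪ S (Rmp a₁ a₂) (Rpm a₁ a₂)))) →
    ¬ Resolving S
lemma4 _ _ (suc _) _ _ _ S (suc b₁ , suc b₂ , (_ , a₁<n₁) , (_ , a₂<n₂) , inj₁ pr₃S⊆) =
  ¬Resolving-if-unresolved-in-layer S i₀ i₁ j₁ j₀ Fin.zero i₀≢i₁
    λ w₁ w₂ w₃ w∈S → antidiagonal-equidistantᶠ w₁ w₂ (pr₃S⊆ (w₁ , w₂ , w₃) w∈S)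
  where open Corner b₁ b₂ a₁<n₁ a₂<n₂
lemma4 _ _ (suc _) _ _ _ S (suc b₁ , suc b₂ , (_ , a₁<n₁) , (_ , a₂<n₂) , inj₂ pr₃S⊆) =
  ¬Resolving-if-unresolved-in-layer S i₀ i₁ j₀ j₁ Fin.zero i₀≢i₁
    λ w₁ w₂ w₃ w∈S → diagonal-equidistantᶠ w₁ w₂ (pr₃S⊆ (w₁ , w₂ , w₃) w∈S)
  where open Corner b₁ b₂ a₁<n₁ a₂<n₂
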